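{- Let $\mathfrak{X}=\{X_i\mid i\in I\}$ be a family of sets. Let $\mathrm{Aut}(\mathfrak{X})$ denote the group (under composition) of automorphisms of $\mathfrak{X}$, and let $F_{\mathfrak{X}}=\bigsqcup_{i\in I}\underline{\chi}(K_{X_i},\bullet):\mathbf{Set}^{\mathbf{inj}}\to\mathbf{Set}^{\mathbf{inj}}$, with $\mathrm{Aut}(F_{\mathfrak{X}})$ the group of natural automorphisms of $F_{\mathfrak{X}}$. Then there is a group isomorphism $\mathrm{Aut}(\mathfrak{X})\to\mathrm{Aut}(F_{\mathfrak{X}})$.
   Context: $\mathbf{Set}^{\mathbf{inj}}$ is the category of sets and injective maps. Graphs are simple undirected graphs $G=(V,E)$. For a graph $G$, the chromatic functor $\underline{\chi}(G,\bullet):\mathbf{Set}^{\mathbf{inj}}\to\mathbf{Set}^{\mathbf{inj}}$ sends a set $S$ to $\underline{\chi}(G,S)=\{c:V\to S\mid c(v)\neq c(u)\text{ whenever }\{v,u\}\in E\}$ and an injection $\iota:S\to T$ to the map $c\mapsto\iota\circ c$. For a set $X$, $K_X$ is the complete graph with vertex set $X$ (so $\underline{\chi}(K_X,S)$ is the set of injections $X\to S$). For two families of sets $\mathfrak{X}=\{X_i\mid i\in I\}$, $\mathfrak{Y}=\{Y_j\mid j\in J\}$, an isomorphism $\mathfrak{X}\to\mathfrak{Y}$ is a collection $(\alpha;\alpha_i)_{i\in I}$ where $\alpha:I\to J$ and $\alpha_i:X_i\to Y_{\alpha(i)}$ are bijections; automorphisms of $\mathfrak{X}$ are isomorphisms $\mathfrak{X}\to\mathfrak{X}$,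 composed in the evident way. -}

module Defs where

open import Level using (Level; suc)
open import Data.Product using (Σ; Σ-syntax; _,_; proj₁; proj₂)
open import Function using (_∘_)
open import Function.Bundles using (_↣_; _↔_; Injection; Inverse; mk↔ₛ′)
open import Function.Construct.Composition using (_↣-∘_; _↔-∘_)
open import Function.Construct.Identity using (↔-id)
open import Function.Construct.Symmetry using (↔-sym)
open import Relation.Binary.PropositionalEquality
  using (_≡_; refl; sym; trans; cong; subst; subst-sym-subst; subst-subst-sym)
open import Algebra.Bundles.Raw using (RawGroup)

-- Conventions.
-- "Sets" are Agda types in a fixed universe  Set ℓ ; the category
-- Set^inj has these as objects and injections  S ↣ T  (stdlib
-- Function.Bundles) as morphisms.  Since there is no function
-- extensionality, equality of maps / elements is stated pointwise.

-- χ(K_X, S): the set of proper colourings of the complete graph K_X with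
-- colours in S, i.e. the injections X → S.
χK : ∀ {ℓ} → Set ℓ → Set ℓ → Set ℓ
χK X S = X ↣ S

χK-map : ∀ {ℓ} {X S T : Set ℓ} → S ↣ T → χK X S → χK X T
χK-map ι c = ι ↣-∘ c

module Family {ℓ : Level} (I : Set ℓ) (X : I → Set ℓ) where

  -- Aut(𝔛): collections (α ; αᵢ) of bijections α : I → I and
  -- αᵢ : X i → X (α i), composed as (β;βᵢ)∘(α;αᵢ) = (β∘α ; β_{α i}∘αᵢ).

  record FamAut : Set ℓ where
    field
      α  : I ↔ I
      αᵢ : (i : I) → X i ↔ X (Inverse.to α i)
  open FamAut public

  _≈A_ : FamAut → FamAut → Set ℓ
  a ≈A b = Σ[ p ∈ (∀ i → Inverse.to (α a) i ≡ Inverse.to (α b) i) ]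
             (∀ i x → subst X (p i) (Inverse.to (αᵢ a i) x)
                        ≡ Inverse.to (αᵢ b i) x)

  idA : FamAut
  idA = record { α = ↔-id I ; αᵢ = λ i → ↔-id (X i) }

  _∙A_ : FamAut → FamAut → FamAut
  b ∙A a = record
    { α  = α b ↔-∘ α a
    ; αᵢ = λ i → αᵢ b (Inverse.to (α a) i) ↔-∘ αᵢ a i }

  transport : ∀ {i j} → i ≡ j → X i ↔ X j
  transport p = mk↔ₛ′ (subst X p) (subst X (sym p))
                      (λ _ → subst-subst-sym p) (λ _ → subst-sym-subst p)

  invA : FamAut → FamAut
  invA a = record
    { α  = ↔-sym (α a)
    ; αᵢ = λ j → ↔-sym (αᵢ a (Inverse.from (α a) j))
                 ↔-∘ transport (sym (Inverse.strictlyInverseˡ (α a) j)) }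

  AutFam : RawGroup ℓ ℓ
  AutFam = record
    { Carrier = FamAut ; _≈_ = _≈A_ ; _∙_ = _∙A_ ; ε = idA ; _⁻¹ = invA }

  F : Set ℓ → Set ℓ
  F S = Σ[ i ∈ I ] χK (X i) S

  Fmap : ∀ {S T : Set ℓ} → S ↣ T → F S → F T
  Fmap ι (i , c) = i , χK-map ι c

  record _≈F_ {S : Set ℓ} (x y : F S) : Set ℓ where
    constructor _,≈_
    field
      idx : proj₁ x ≡ proj₁ y
      pt  : ∀ a → Injection.to (proj₂ x) a
                    ≡ Injection.to (proj₂ y) (subst X idx a)

  ≈F-refl : ∀ {S} {x : F S} → x ≈F x
  ≈F-refl = refl ,≈ λ _ → refl

  ≈F-trans : ∀ {S} {x y z : F S} → x ≈F y → y ≈F z → x ≈F z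
  ≈F-trans {x = _ , _} {_ , _} {_ , _} (refl ,≈ q) (refl ,≈ r) =
    refl ,≈ λ a → trans (q a) (r a)

  ≈F-sym : ∀ {S} {x y : F S} → x ≈F y → y ≈F x
  ≈F-sym {x = _ , _} {_ , _} (refl ,≈ q) = refl ,≈ λ a → sym (q a)

  Fmap-cong : ∀ {S T} (ι : S ↣ T) {x y : F S} → x ≈F y → Fmap ι x ≈F Fmap ι y
  Fmap-cong ι {_ , _} {_ , _} (refl ,≈ q) =
    refl ,≈ λ a → cong (Injection.to ι) (q a)

  record NatAut : Set (suc ℓ) where
    field
      η        : (S : Set ℓ) → F S → F S
      η⁻¹      : (S : Set ℓ) → F S → F S
      η-cong   : ∀ S {x y : F S} → x ≈F y → η S x ≈F η S y
      η⁻¹-cong : ∀ S {x y : F S} → x ≈F y → η⁻¹ S x ≈F η⁻¹ S y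
      η-natural   : ∀ {S T} (ι : S ↣ T) (x : F S) →
                    η T (Fmap ι x) ≈F Fmap ι (η S x)
      η⁻¹-natural : ∀ {S T} (ι : S ↣ T) (x : F S) →
                    η⁻¹ T (Fmap ι x) ≈F Fmap ι (η⁻¹ S x)
      inverseˡ : ∀ S (x : F S) → η⁻¹ S (η S x) ≈F x
      inverseʳ : ∀ S (x : F S) → η S (η⁻¹ S x) ≈F x
  open NatAut public

  _≈N_ : NatAut → NatAut → Set (suc ℓ)
  θ ≈N φ = ∀ (S : Set ℓ) (x : F S) → η θ S x ≈F η φ S x

  idN : NatAut
  idN = record
    { η = λ _ x → x ; η⁻¹ = λ _ x → x
    ; η-cong = λ _ p → p ; η⁻¹-cong = λ _ p → p
    ; η-natural = λ _ _ → ≈F-refl ; η⁻¹-natural = λ _ _ → ≈F-refl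
    ; inverseˡ = λ _ _ → ≈F-refl ; inverseʳ = λ _ _ → ≈F-refl }

  _∙N_ : NatAut → NatAut → NatAut
  θ ∙N φ = record
    { η   = λ S → η θ S ∘ η φ S
    ; η⁻¹ = λ S → η⁻¹ φ S ∘ η⁻¹ θ S
    ; η-cong   = λ S p → η-cong θ S (η-cong φ S p)
    ; η⁻¹-cong = λ S p → η⁻¹-cong φ S (η⁻¹-cong θ S p)
    ; η-natural = λ {S} {T} ι x →
        ≈F-trans (η-cong θ T (η-natural φ ι x)) (η-natural θ ι (η φ S x))
    ; η⁻¹-natural = λ {S} {T} ι x →
        ≈F-trans (η⁻¹-cong φ T (η⁻¹-natural θ ι x)) (η⁻¹-natural φ ι (η⁻¹ θ S x))
    ; inverseˡ = λ S x →
        ≈F-trans (η⁻¹-cong φ S (inverseˡ θ S (η φ S x))) (inverseˡ φ S x)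
    ; inverseʳ = λ S x →
        ≈F-trans (η-cong θ S (inverseʳ φ S (η⁻¹ θ S x))) (inverseʳ θ S x) }

  invN : NatAut → NatAut
  invN θ = record
    { η = η⁻¹ θ ; η⁻¹ = η θ
    ; η-cong = η⁻¹-cong θ ; η⁻¹-cong = η-cong θ
    ; η-natural = η⁻¹-natural θ ; η⁻¹-natural = η-natural θ
    ; inverseˡ = inverseʳ θ ; inverseʳ = inverseˡ θ }

  AutF : RawGroup (suc ℓ) (suc ℓ)
  AutF = record
    { Carrier = NatAut ; _≈_ = _≈N_ ; _∙_ = _∙N_ ; ε = idN ; _⁻¹ = invN }

-- A family automorphism (α ; αᵢ) acts on F_𝔛 by (i , c) ↦ (α i , c ∘ αᵢ⁻¹), and this
-- is a group homomorphism.  Conversely, by the Yoneda lemma a natural automorphism θ is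
-- determined by its values θ(i , id) = (α i , eᵢ) on the universal elements
-- (i , id) ∈ F(X i); naturality of θ⁻¹ shows that i ↦ α i is a bijection and that each
-- injection eᵢ : X (α i) ↣ X i has a section, hence is a bijection, and (α ; eᵢ⁻¹) is
-- the family automorphism acting as θ.
module Submission where

open import Defs
open import Level using (Level)
open import Data.Product using (Σ-syntax; _,_; proj₁; proj₂)
open import Algebra.Morphism.Structures using (module GroupMorphisms)
open import Function.Bundles using (_↣_; _↔_; Injection; Inverse; mk↔ₛ′)
open import Function.Construct.Composition using (_↣-∘_)
open import Function.Construct.Identity using (↣-id)
open import Function.Construct.Symmetry using (↔-sym)
open import Function.Properties.Inverse using (↔⇒↣)
open import Relation.Binary.PropositionalEquality
  using (_≡_; refl; sym; trans; cong; subst; subst-subst-sym)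

open Inverse using (to; from; strictlyInverseˡ; strictlyInverseʳ)
open Injection using (injective)

_∘⁻¹_ : ∀ {a} {Y Z S : Set a} → Y ↣ S → Y ↔ Z → Z ↣ S
c ∘⁻¹ g = c ↣-∘ ↔⇒↣ (↔-sym g)

↣-section⇒↔ : ∀ {a} {A B : Set a} (c : B ↣ A) (s : A → B) →
              (∀ x → Injection.to c (s x) ≡ x) → A ↔ B
↣-section⇒↔ c s section =
  mk↔ₛ′ s (Injection.to c) (λ y → injective c (section (Injection.to c y))) section

module _ {a p} {A : Set a} (P : A → Set p) where

  subst∘to≗to⇒from≗from∘subst : ∀ {i j k} (e : j ≡ k) (f : P i ↔ P j) (g : P i ↔ P k) →
    (∀ x → subst P e (to f x) ≡ to g x) → ∀ y → from f y ≡ from g (subst P e y)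
  subst∘to≗to⇒from≗from∘subst refl f g h y =
    sym (trans (cong (from g) (trans (sym (strictlyInverseˡ f y)) (h (from f y))))
               (strictlyInverseʳ g (from f y)))

  from≗from∘subst⇒subst∘to≗to : ∀ {i j k} (e : j ≡ k) (f : P i ↔ P j) (g : P i ↔ P k) →
    (∀ y → from f y ≡ from g (subst P e y)) → ∀ x → subst P e (to f x) ≡ to g x
  from≗from∘subst⇒subst∘to≗to refl f g h x =
    sym (trans (cong (to g) (trans (sym (strictlyInverseʳ f x)) (h (to f x))))
               (strictlyInverseˡ g (to f x)))

module _ {ℓ : Level} (I : Set ℓ) (X : I → Set ℓ) where
  open Family I X
  open _≈F_

  invA-inverseʳ : ∀ a → (a ∙A invA a) ≈A idA
  invA-inverseʳ a = strictlyInverseˡ (α a) , λ j x →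
    let q = strictlyInverseˡ (α a) j in
    trans (cong (subst X q) (strictlyInverseˡ (αᵢ a (from (α a) j)) _)) (subst-subst-sym q)

  -- The inverse laws of α need not be coherent, so s need not be cong (to α) r; K disposes of it.
  subst-from-subst-to : ∀ a {i k} (r : k ≡ i) (s : to (α a) k ≡ to (α a) i) (x : X i) →
    subst X r (from (αᵢ a k) (subst X (sym s) (to (αᵢ a i) x))) ≡ x
  subst-from-subst-to a {i} refl refl = strictlyInverseʳ (αᵢ a i)

  invA-inverseˡ : ∀ a → (invA a ∙A a) ≈A idA
  invA-inverseˡ a = strictlyInverseʳ (α a) , λ i →
    subst-from-subst-to a (strictlyInverseʳ (α a) i) (strictlyInverseˡ (α a) (to (α a) i))

  act : FamAut → (S : Set ℓ) → F S → F S
  act a S (i , c) = to (α a) i , c ∘⁻¹ αᵢ a i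

  act-cong : ∀ a S {x y : F S} → x ≈F y → act a S x ≈F act a S y
  act-cong a S {i , _} {_ , _} (refl ,≈ q) = refl ,≈ λ y → q (from (αᵢ a i) y)

  act-∙A : ∀ b a S (x : F S) → act (b ∙A a) S x ≈F act b S (act a S x)
  act-∙A b a S (_ , _) = refl ,≈ λ _ → refl

  act-idA : ∀ S (x : F S) → act idA S x ≈F x
  act-idA S (_ , _) = refl ,≈ λ _ → refl

  act-resp-≈A : ∀ {a b} → a ≈A b → ∀ S (x : F S) → act a S x ≈F act b S x
  act-resp-≈A {a} {b} (p , q) S (i , c) = p i ,≈ λ y →
    cong (Injection.to c) (subst∘to≗to⇒from≗from∘subst X (p i) (αᵢ a i) (αᵢ b i) (q i) y)

  act-inverse : ∀ a b → (b ∙A a) ≈A idA → ∀ S (x : F S) → act b S (act a S x) ≈F x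
  act-inverse a b ba≈id S x =
    ≈F-trans (≈F-sym (act-∙A b a S x))
             (≈F-trans (act-resp-≈A {b ∙A a} {idA} ba≈id S x) (act-idA S x))

  toNatAut : FamAut → NatAut
  toNatAut a = record
    { η = act a ; η⁻¹ = act (invA a)
    ; η-cong = act-cong a ; η⁻¹-cong = act-cong (invA a)
    ; η-natural = λ { _ (_ , _) → refl ,≈ λ _ → refl }
    ; η⁻¹-natural = λ { _ (_ , _) → refl ,≈ λ _ → refl }
    ; inverseˡ = act-inverse a (invA a) (invA-inverseˡ a)
    ; inverseʳ = act-inverse (invA a) a (invA-inverseʳ a) }

  universal : (i : I) → F (X i)
  universal i = i , ↣-id (X i)

  toNatAut-injective : ∀ {a b} → toNatAut a ≈N toNatAut b → a ≈A b
  toNatAut-injective {a} {b} h = (λ i → idx (at i)) , λ i →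
    from≗from∘subst⇒subst∘to≗to X (idx (at i)) (αᵢ a i) (αᵢ b i) (pt (at i))
    where at = λ i → h (X i) (universal i)

  module _ (θ : NatAut) where

    index : I → I
    index i = proj₁ (η θ (X i) (universal i))

    component : ∀ i → X (index i) ↣ X i
    component i = proj₂ (η θ (X i) (universal i))

    η-universal : ∀ S i (c : X i ↣ S) → η θ S (i , c) ≈F Fmap c (η θ (X i) (universal i))
    η-universal S i c = ≈F-trans (η-cong θ S (refl ,≈ λ _ → refl)) (η-natural θ c (universal i))

  Fmap-component-η⁻¹-universal : ∀ θ i →
    Fmap (component θ i) (η⁻¹ θ _ (universal (index θ i))) ≈F universal i
  Fmap-component-η⁻¹-universal θ i =
    ≈F-trans (≈F-sym (η-universal (invN θ) (X i) (index θ i) (component θ i)))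
             (inverseˡ θ (X i) (universal i))

  index-inverse : ∀ θ i → index (invN θ) (index θ i) ≡ i
  index-inverse θ i = idx (Fmap-component-η⁻¹-universal θ i)

  component-section : ∀ θ i (x : X i) →
    Injection.to (component θ i)
      (Injection.to (component (invN θ) (index θ i)) (subst X (sym (index-inverse θ i)) x)) ≡ x
  component-section θ i x =
    trans (pt (Fmap-component-η⁻¹-universal θ i) _) (subst-subst-sym (index-inverse θ i))

  fromNatAut : NatAut → FamAut
  fromNatAut θ = record
    { α  = mk↔ₛ′ (index θ) (index (invN θ)) (index-inverse (invN θ)) (index-inverse θ)
    ; αᵢ = λ i → ↣-section⇒↔ (component θ i) _ (component-section θ i) }

  toNatAut-fromNatAut : ∀ θ → toNatAut (fromNatAut θ) ≈N θ
  toNatAut-fromNatAut θ S (i , c) = ≈F-sym (≈F-trans (η-universal θ S i c) (refl ,≈ λ _ → refl))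

  open GroupMorphisms AutFam AutF

  toNatAut-isGroupIsomorphism : IsGroupIsomorphism toNatAut
  toNatAut-isGroupIsomorphism = record
    { isGroupMonomorphism = record
      { isGroupHomomorphism = record
        { isMonoidHomomorphism = record
          { isMagmaHomomorphism = record
            { isRelHomomorphism = record { cong = λ {a} {b} → act-resp-≈A {a} {b} }
            ; homo = act-∙A }
          ; ε-homo = act-idA }
        ; ⁻¹-homo = λ _ _ _ → ≈F-refl }
      ; injective = λ {a} {b} → toNatAut-injective {a} {b} }
    ; surjective = λ θ → fromNatAut θ , λ {a} a≈ S x →
        ≈F-trans (act-resp-≈A {a} {fromNatAut θ} a≈ S x) (toNatAut-fromNatAut θ S x) }

corollary2p2 : ∀ {ℓ : Level} (I : Set ℓ) (X : I → Set ℓ) →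
    Σ[ f ∈ (Family.FamAut I X → Family.NatAut I X) ]
      GroupMorphisms.IsGroupIsomorphism (Family.AutFam I X) (Family.AutF I X) f
corollary2p2 I X = toNatAut I X , toNatAut-isGroupIsomorphism I X
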